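{- Let $(y_n)_{n\ge1}$ be a nondecreasing sequence of nonnegative integers, with output array $A(n,k)$ and output sequence $W(n)$. Then for $n\ge2$ and $0\le k\le y_n$, $$\min(y_{n-1}+1,\,k+1)\le A(n,k),$$ and for all $n\ge1$, $k\ge0$, $$A(n,k)\le\binom{n-1+k}{k},\qquad W(n)\le\binom{n+y_n}{y_n}.$$
   Context: For a nondecreasing sequence $(y_n)_{n\ge1}$ of nonnegative integers and a positive integer $n$, an $n$-tuple $(x_1,\dots,x_n)$ of nonnegative integers is valid if $x_1\le y_n$ and $x_{j+1}\le\min(x_j,y_{n-j})$ for $1\le j\le n-1$. The output array $A(n,k)$ ($n\ge1$, $k\ge0$) is the number of valid $n$-tuples with $x_1=k$, and the output sequence is $W(n)=\sum_{k\ge0}A(n,k)=\sum_{k=0}^{y_n}A(n,k)$, the number of valid $n$-tuples. -}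

module Defs where

open import Data.Nat using (ℕ; zero; suc; _≤_; _≤?_; _≟_)
open import Data.Unit using (⊤; tt)
open import Data.Empty using (⊥)
open import Data.Product using (_×_; _,_)
open import Data.List using (List; []; _∷_; map; concatMap; upTo; filter; length)
open import Data.Vec using (Vec; []; _∷_)
open import Relation.Nullary using (Dec; yes; no)
open import Relation.Nullary.Decidable using (_×-dec_)
open import Relation.Binary.PropositionalEquality using (_≡_)

-- The sequence (y_n)_{n≥1} is modelled as y : ℕ → ℕ; the value y 0 is never used.
-- Nondecreasing (on indices ≥ 1).
Nondecreasing : (ℕ → ℕ) → Set
Nondecreasing y = ∀ i j → 1 ≤ i → i ≤ j → y i ≤ y j

-- The entry x_{j} sits at a position whose
-- suffix (including itself) has length n-j+1, so the bound x_{j+1} ≤ y_{n-j} (and x_1 ≤ y_n)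
-- says: every entry is ≤ y (length of the suffix starting at it).
Bounded : (ℕ → ℕ) → ∀ {m} → Vec ℕ m → Set
Bounded y [] = ⊤
Bounded y {suc m} (x ∷ xs) = (x ≤ y (suc m)) × Bounded y xs

Descending : ∀ {m} → Vec ℕ m → Set
Descending [] = ⊤
Descending (x ∷ []) = ⊤
Descending (x ∷ x' ∷ xs) = (x' ≤ x) × Descending (x' ∷ xs)

Valid : (ℕ → ℕ) → ∀ {n} → Vec ℕ n → Set
Valid y x = Bounded y x × Descending x

HeadIs : ℕ → ∀ {n} → Vec ℕ n → Set
HeadIs k [] = ⊥
HeadIs k (x ∷ xs) = x ≡ k

bounded? : (y : ℕ → ℕ) → ∀ {m} (x : Vec ℕ m) → Dec (Bounded y x)
bounded? y [] = yes tt
bounded? y {suc m} (x ∷ xs) = (x ≤? y (suc m)) ×-dec bounded? y xs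

descending? : ∀ {m} (x : Vec ℕ m) → Dec (Descending x)
descending? [] = yes tt
descending? (x ∷ []) = yes tt
descending? (x ∷ x' ∷ xs) = (x' ≤? x) ×-dec descending? (x' ∷ xs)

valid? : (y : ℕ → ℕ) → ∀ {n} (x : Vec ℕ n) → Dec (Valid y x)
valid? y x = bounded? y x ×-dec descending? x

headIs? : (k : ℕ) → ∀ {n} (x : Vec ℕ n) → Dec (HeadIs k x)
headIs? k [] = no (λ ())
headIs? k (x ∷ xs) = x ≟ k

allVecs : (n b : ℕ) → List (Vec ℕ n)
allVecs zero b = [] ∷ []
allVecs (suc n) b = concatMap (λ x → map (x ∷_) (allVecs n b)) (upTo (suc b))

-- Every valid n-tuple has all entries ≤ x_1 ≤ y_n, so it occurs (once) in allVecs n (y n);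
-- hence the following lengths are the numbers of valid tuples.

A : (ℕ → ℕ) → ℕ → ℕ → ℕ
A y n k = length (filter (λ x → valid? y x ×-dec headIs? k x) (allVecs n (y n)))

W : (ℕ → ℕ) → ℕ → ℕ
W y n = length (filter (valid? y) (allVecs n (y n)))

{-# OPTIONS --safe #-}
-- Splitting a tuple into its first entry x ≤ b and its tail turns a count of
-- (m+1)-tuples with entries ≤ b into a sum over x of counts of m-tuples.  Forgetting the
-- bounds y, the descending tuples behind a head k are then counted by a sum of the same
-- shape over the next entry j ≤ k, and the hockey-stick identity
-- ∑_{j ≤ k} C(m+j, j) = C(m+1+k, k) gives both upper bounds by induction on the length.
-- For the lower bound, the tuples (k, j, 0, …, 0) with j ≤ min(y_{n-1}, k) are valid.
module Submission where

open import Defs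
open import Data.Nat using (ℕ; zero; suc; _+_; _∸_; _≤_; _<_; _⊓_; z≤n; s≤s; _≤?_)
open import Data.Nat.Properties
open import Data.Nat.Combinatorics using (_C_; nCn≡1; nCk+nC[k+1]≡[n+1]C[k+1])
open import Data.Product using (_×_; _,_; proj₁; proj₂)
open import Data.List using (List; []; _∷_; _++_; map; concatMap; upTo; filter; length; [_])
open import Data.List.Properties using (filter-++; length-++; filter-none; map-++; upTo-∷ʳ)
open import Data.Nat.ListAction using (sum)
open import Data.Nat.ListAction.Properties using (sum-++)
import Data.List.Relation.Unary.All as All
open import Data.Vec using (Vec; []; _∷_; replicate)
open import Data.Sum using (inj₁; inj₂)
open import Data.Unit using (tt)
open import Data.Empty using (⊥-elim)
open import Function using (_∘_)
open import Level using (0ℓ)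
open import Relation.Nullary using (yes; no; ¬_)
open import Relation.Nullary.Decidable using (_×-dec_)
open import Relation.Unary using (Pred; Decidable)
open import Relation.Binary.PropositionalEquality hiding ([_])

∑< : ℕ → (ℕ → ℕ) → ℕ
∑< zero    f = 0
∑< (suc c) f = ∑< c f + f c

syntax ∑< c (λ x → e) = ∑[ x < c ] e

module _ (f : ℕ → ℕ) where

  ∑-upTo : ∀ c → sum (map f (upTo c)) ≡ ∑< c f
  ∑-upTo zero    = refl
  ∑-upTo (suc c) = begin
    sum (map f (upTo (suc c)))       ≡⟨ cong (sum ∘ map f) (upTo-∷ʳ c) ⟨
    sum (map f (upTo c ++ [ c ]))    ≡⟨ cong sum (map-++ f (upTo c) [ c ]) ⟩
    sum (map f (upTo c) ++ [ f c ])  ≡⟨ sum-++ (map f (upTo c)) [ f c ] ⟩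
    sum (map f (upTo c)) + (f c + 0) ≡⟨ cong₂ _+_ (∑-upTo c) (+-identityʳ (f c)) ⟩
    ∑< c f + f c                     ∎
    where open ≡-Reasoning

  ∑-monoˡ-≤ : ∀ {c d} → c ≤ d → ∑< c f ≤ ∑< d f
  ∑-monoˡ-≤ {d = zero}  z≤n = ≤-refl
  ∑-monoˡ-≤ {c} {suc d} c≤1+d with m≤n⇒m<n∨m≡n c≤1+d
  ... | inj₁ c<1+d = ≤-trans (∑-monoˡ-≤ (m<1+n⇒m≤n c<1+d)) (m≤m+n (∑< d f) (f d))
  ... | inj₂ refl  = ≤-refl

  ∑-term : ∀ {c j} → j < c → f j ≤ ∑< c f
  ∑-term {suc c} {j} j<1+c = ≤-trans (m≤n+m (f j) (∑< j f)) (∑-monoˡ-≤ j<1+c)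

  ∑-zero : ∀ c → (∀ x → x < c → f x ≡ 0) → ∑< c f ≡ 0
  ∑-zero zero    _  = refl
  ∑-zero (suc c) f0 = cong₂ _+_ (∑-zero c (λ x → f0 x ∘ m≤n⇒m≤1+n)) (f0 c ≤-refl)

  ∑-vanishing-above : ∀ c {k} → (∀ x → k < x → f x ≡ 0) → ∑< c f ≤ ∑< (suc k) f
  ∑-vanishing-above zero    _  = z≤n
  ∑-vanishing-above (suc c) {k} f0 with c ≤? k
  ... | yes c≤k = ∑-monoˡ-≤ (s≤s c≤k)
  ... | no  c≰k = begin
    ∑< c f + f c ≡⟨ cong (∑< c f +_) (f0 c (≰⇒> c≰k)) ⟩
    ∑< c f + 0   ≡⟨ +-identityʳ (∑< c f) ⟩
    ∑< c f       ≤⟨ ∑-vanishing-above c f0 ⟩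
    ∑< (suc k) f ∎
    where open ≤-Reasoning

  ∑-single : ∀ c k → (∀ x → x ≢ k → f x ≡ 0) → ∑< c f ≤ f k
  ∑-single c k f0 = begin
    ∑< c f       ≤⟨ ∑-vanishing-above c (λ x k<x → f0 x (≢-sym (<⇒≢ k<x))) ⟩
    ∑< k f + f k ≡⟨ cong (_+ f k) (∑-zero k (λ x → f0 x ∘ <⇒≢)) ⟩
    f k          ∎
    where open ≤-Reasoning

  ∑-≥-length : ∀ c → (∀ x → x < c → 1 ≤ f x) → c ≤ ∑< c f
  ∑-≥-length zero    _  = z≤n
  ∑-≥-length (suc c) f1 = subst (_≤ ∑< c f + f c) (+-comm c 1)
    (+-mono-≤ (∑-≥-length c (λ x → f1 x ∘ m≤n⇒m≤1+n)) (f1 c ≤-refl))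

∑-mono-≤ : ∀ c {f g : ℕ → ℕ} → (∀ x → x < c → f x ≤ g x) → ∑< c f ≤ ∑< c g
∑-mono-≤ zero    _   = z≤n
∑-mono-≤ (suc c) f≤g = +-mono-≤ (∑-mono-≤ c (λ x → f≤g x ∘ m≤n⇒m≤1+n)) (f≤g c ≤-refl)

∑-cong : ∀ c {f g : ℕ → ℕ} → (∀ x → f x ≡ g x) → ∑< c f ≡ ∑< c g
∑-cong zero    _   = refl
∑-cong (suc c) f≡g = cong₂ _+_ (∑-cong c f≡g) (f≡g c)

hockey-stick : ∀ m k → ∑[ j < suc k ] ((m + j) C j) ≡ (suc m + k) C k
hockey-stick m zero    = refl
hockey-stick m (suc k) = begin
  ∑[ j < suc k ] ((m + j) C j) + (m + suc k) C suc k ≡⟨ cong (_+ (m + suc k) C suc k) (hockey-stick m k) ⟩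
  (suc m + k) C k + (m + suc k) C suc k              ≡⟨ cong (λ n → n C k + (m + suc k) C suc k) (+-suc m k) ⟨
  (m + suc k) C k + (m + suc k) C suc k              ≡⟨ nCk+nC[k+1]≡[n+1]C[k+1] (m + suc k) k ⟩
  suc (m + suc k) C suc k                            ∎
  where open ≡-Reasoning

count : {X : Set} {P : Pred X 0ℓ} → Decidable P → List X → ℕ
count P? = length ∘ filter P?

module _ {X : Set} {P : Pred X 0ℓ} (P? : Decidable P) where

  count-++ : ∀ xs ys → count P? (xs ++ ys) ≡ count P? xs + count P? ys
  count-++ xs ys = trans (cong length (filter-++ P? xs ys)) (length-++ (filter P? xs))

  count-concatMap : {W : Set} (f : W → List X) (ws : List W) →
    count P? (concatMap f ws) ≡ sum (map (count P? ∘ f) ws)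
  count-concatMap f []       = refl
  count-concatMap f (w ∷ ws) =
    trans (count-++ (f w) (concatMap f ws)) (cong (count P? (f w) +_) (count-concatMap f ws))

  count-map : {W : Set} (g : W → X) (ws : List W) → count P? (map g ws) ≡ count (P? ∘ g) ws
  count-map g []       = refl
  count-map g (w ∷ ws) with P? (g w)
  ... | yes _ = cong suc (count-map g ws)
  ... | no  _ = count-map g ws

  count-none : (∀ x → ¬ P x) → ∀ xs → count P? xs ≡ 0
  count-none ¬P xs = cong length (filter-none P? (All.universal ¬P xs))

  count-mono : {Q : Pred X 0ℓ} (Q? : Decidable Q) → (∀ x → P x → Q x) →
    ∀ xs → count P? xs ≤ count Q? xs
  count-mono Q? P⇒Q []       = z≤n
  count-mono Q? P⇒Q (x ∷ xs) with P? x | Q? x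
  ... | yes _  | yes _  = s≤s (count-mono Q? P⇒Q xs)
  ... | yes px | no ¬qx = ⊥-elim (¬qx (P⇒Q x px))
  ... | no  _  | yes _  = m≤n⇒m≤1+n (count-mono Q? P⇒Q xs)
  ... | no  _  | no  _  = count-mono Q? P⇒Q xs

module _ (m b : ℕ) {P : Pred (Vec ℕ (suc m)) 0ℓ} (P? : Decidable P) where

  private
    behind : ℕ → ℕ
    behind x = count (P? ∘ (x ∷_)) (allVecs m b)

  count-allVecs-suc : count P? (allVecs (suc m) b) ≡ ∑[ x < suc b ] count (P? ∘ (x ∷_)) (allVecs m b)
  count-allVecs-suc = begin
    count P? (allVecs (suc m) b)                  ≡⟨ count-concatMap P? prefixed (upTo (suc b)) ⟩
    sum (map (count P? ∘ prefixed) (upTo (suc b))) ≡⟨ ∑-upTo (count P? ∘ prefixed) (suc b) ⟩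
    ∑< (suc b) (count P? ∘ prefixed)               ≡⟨ ∑-cong (suc b) (λ x → count-map P? (x ∷_) (allVecs m b)) ⟩
    ∑< (suc b) behind                              ∎
    where
    open ≡-Reasoning
    prefixed : ℕ → List (Vec ℕ (suc m))
    prefixed x = map (x ∷_) (allVecs m b)

  count-allVecs-head : ∀ {x} → x ≤ b → count (P? ∘ (x ∷_)) (allVecs m b) ≤ count P? (allVecs (suc m) b)
  count-allVecs-head {x} x≤b = subst (behind x ≤_) (sym count-allVecs-suc) (∑-term behind (s≤s x≤b))

count-allVecs-headIs : (m b k : ℕ) {P : Pred (Vec ℕ (suc m)) 0ℓ} (P? : Decidable P) →
  count (λ v → P? v ×-dec headIs? k v) (allVecs (suc m) b) ≤ count (P? ∘ (k ∷_)) (allVecs m b)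
count-allVecs-headIs m b k {P} P? = begin
  count Q? (allVecs (suc m) b)                     ≡⟨ count-allVecs-suc m b Q? ⟩
  ∑[ x < suc b ] count (Q? ∘ (x ∷_)) (allVecs m b) ≤⟨ ∑-single (λ x → count (Q? ∘ (x ∷_)) (allVecs m b)) (suc b) k
                                                        (λ x x≢k → count-none _ (λ _ → x≢k ∘ proj₂) (allVecs m b)) ⟩
  count (Q? ∘ (k ∷_)) (allVecs m b)                ≤⟨ count-mono _ _ (λ _ → proj₁) (allVecs m b) ⟩
  count (P? ∘ (k ∷_)) (allVecs m b)                ∎
  where
  open ≤-Reasoning
  Q? : Decidable (λ v → P v × HeadIs k v)
  Q? v = P? v ×-dec headIs? k v

count-allVecs-replicate : (m b : ℕ) {P : Pred (Vec ℕ m) 0ℓ} (P? : Decidable P) →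
  P (replicate m 0) → 1 ≤ count P? (allVecs m b)
count-allVecs-replicate zero    b P? p with P? []
... | yes _ = s≤s z≤n
... | no ¬p = ⊥-elim (¬p p)
count-allVecs-replicate (suc m) b P? p =
  ≤-trans (count-allVecs-replicate m b (P? ∘ (0 ∷_)) p) (count-allVecs-head m b P? z≤n)

descendingTails : (m b k : ℕ) → ℕ
descendingTails m b k = count (descending? ∘ (k ∷_)) (allVecs m b)

descendingTails≤C : ∀ m b k → descendingTails m b k ≤ (m + k) C k
descendingTails≤C zero    b k = ≤-reflexive (sym (nCn≡1 k))
descendingTails≤C (suc m) b k = begin
  descendingTails (suc m) b k                  ≡⟨ count-allVecs-suc m b (descending? ∘ (k ∷_)) ⟩
  ∑< (suc b) behind                            ≤⟨ ∑-vanishing-above behind (suc b)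
                                                    (λ j k<j → count-none _ (λ _ → <⇒≱ k<j ∘ proj₁) (allVecs m b)) ⟩
  ∑< (suc k) behind                            ≤⟨ ∑-mono-≤ (suc k) (λ j _ → count-mono _ _ (λ _ → proj₂) (allVecs m b)) ⟩
  ∑[ j < suc k ] descendingTails m b j         ≤⟨ ∑-mono-≤ (suc k) (λ j _ → descendingTails≤C m b j) ⟩
  ∑[ j < suc k ] ((m + j) C j)                 ≡⟨ hockey-stick m k ⟩
  (suc m + k) C k                              ∎
  where
  open ≤-Reasoning
  behind : ℕ → ℕ
  behind j = count (λ v → descending? (k ∷ j ∷ v)) (allVecs m b)

m<n+1⇒m≤n : ∀ {j n} → j < n + 1 → j ≤ n
m<n+1⇒m≤n {j} {n} = m<1+n⇒m≤n ∘ subst (j <_) (+-comm n 1)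

replicate-bounded : (y : ℕ → ℕ) → ∀ m → Bounded y (replicate m 0)
replicate-bounded y zero    = tt
replicate-bounded y (suc m) = z≤n , replicate-bounded y m

∷-replicate-descending : ∀ j m → Descending (j ∷ replicate m 0)
∷-replicate-descending j zero    = tt
∷-replicate-descending j (suc m) = z≤n , ∷-replicate-descending 0 m

A-lower : (y : ℕ → ℕ) (n k : ℕ) → 2 ≤ n → k ≤ y n → (y (n ∸ 1) + 1) ⊓ (k + 1) ≤ A y n k
A-lower y (suc (suc m)) k (s≤s (s≤s z≤n)) k≤b = begin
  c                                                 ≤⟨ ∑-≥-length behind c witness ⟩
  ∑< c behind                                       ≤⟨ ∑-monoˡ-≤ behind c≤1+b ⟩
  ∑< (suc b) behind                                 ≡⟨ count-allVecs-suc m b (Q? ∘ (k ∷_)) ⟨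
  count (Q? ∘ (k ∷_)) (allVecs (suc m) b)           ≤⟨ count-allVecs-head (suc m) b Q? k≤b ⟩
  A y (suc (suc m)) k                               ∎
  where
  open ≤-Reasoning
  b c : ℕ
  b = y (suc (suc m))
  c = (y (suc m) + 1) ⊓ (k + 1)
  Q? : Decidable (λ (v : Vec ℕ (suc (suc m))) → Valid y v × HeadIs k v)
  Q? v = valid? y v ×-dec headIs? k v
  c≤1+b : c ≤ suc b
  c≤1+b = ≤-trans (m⊓n≤n _ (k + 1)) (subst (_≤ suc b) (+-comm 1 k) (s≤s k≤b))
  behind : ℕ → ℕ
  behind j = count (Q? ∘ (k ∷_) ∘ (j ∷_)) (allVecs m b)
  witness : ∀ j → j < c → 1 ≤ behind j
  witness j j<c = count-allVecs-replicate m b _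
    (((k≤b , j≤y , replicate-bounded y m) , j≤k , ∷-replicate-descending j m) , refl)
    where
    j≤y : j ≤ y (suc m)
    j≤y = m<n+1⇒m≤n (m<n⊓o⇒m<n _ (k + 1) j<c)
    j≤k : j ≤ k
    j≤k = m<n+1⇒m≤n (m<n⊓o⇒m<o (y (suc m) + 1) _ j<c)

A-upper : (y : ℕ → ℕ) (n k : ℕ) → 1 ≤ n → A y n k ≤ (n ∸ 1 + k) C k
A-upper y (suc m) k (s≤s z≤n) = begin
  A y (suc m) k                                                     ≤⟨ forgetBounds ⟩
  count (λ v → descending? v ×-dec headIs? k v) (allVecs (suc m) b) ≤⟨ count-allVecs-headIs m b k descending? ⟩
  descendingTails m b k                                             ≤⟨ descendingTails≤C m b k ⟩
  (m + k) C k                                                       ∎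
  where
  open ≤-Reasoning
  b : ℕ
  b = y (suc m)
  forgetBounds : A y (suc m) k ≤ count (λ v → descending? v ×-dec headIs? k v) (allVecs (suc m) b)
  forgetBounds = count-mono _ _ (λ _ → λ { ((_ , d) , h) → d , h }) (allVecs (suc m) b)

W-upper : (y : ℕ → ℕ) (n : ℕ) → 1 ≤ n → W y n ≤ (n + y n) C (y n)
W-upper y (suc m) (s≤s z≤n) = begin
  W y (suc m)                              ≤⟨ count-mono _ descending? (λ _ → proj₂) (allVecs (suc m) b) ⟩
  count descending? (allVecs (suc m) b)    ≡⟨ count-allVecs-suc m b descending? ⟩
  ∑[ x < suc b ] descendingTails m b x     ≤⟨ ∑-mono-≤ (suc b) (λ x _ → descendingTails≤C m b x) ⟩
  ∑[ x < suc b ] ((m + x) C x)             ≡⟨ hockey-stick m b ⟩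
  (suc m + b) C b                          ∎
  where
  open ≤-Reasoning
  b : ℕ
  b = y (suc m)

theorem5p1 : (y : ℕ → ℕ) → Nondecreasing y →
    ((n k : ℕ) → 2 ≤ n → k ≤ y n → (y (n ∸ 1) + 1) ⊓ (k + 1) ≤ A y n k)
    × ((n k : ℕ) → 1 ≤ n → A y n k ≤ (n ∸ 1 + k) C k)
    × ((n : ℕ) → 1 ≤ n → W y n ≤ (n + y n) C (y n))
theorem5p1 y _ = A-lower y , A-upper y , W-upper y
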